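{- Let $n=p'q$ where $p',q$ are distinct primes, both at least $7$, and let $A=L(n;p')$. Let $S=(x_1,x_2,x_3)$ be a sequence in $\mathbb{Z}_n$ which is equivalent with respect to $A$ to a sequence $(y_1,y_2,y_3)$ for which one of the following holds: (i) $y_1$ is the only term divisible by $q$, $y_1\neq 0$, and the image of $(y_2,y_3)$ under the natural map $\mathbb{Z}_n\to\mathbb{Z}_q$ is a $Q_q$-extremal sequence for the Davenport constant; (ii) $y_1$ is the only term coprime to $p'$, and the image of $(y_2,y_3)$ under the natural map $\mathbb{Z}_n\to\mathbb{Z}_q$ is a $Q_q$-extremal sequence for the Davenport constant. Then $S$ is an $A$-extremal sequence for the Davenport constant.
   Context: For $m\geq 2$, $\mathbb{Z}_m=\mathbb{Z}/m\mathbb{Z}$, $U(m)$ its unit group; for $d\mid m$ the natural map $\mathbb{Z}_m\to\mathbb{Z}_d$ is reduction mod $d$. For an odd prime $q$, $Q_q=\{x^2: x\in U(q)\}$. For nonempty $A\subseteq\mathbb{Z}_m\setminus\{0\}$, a sequence $(x_1,\ldots,x_l)$ is an $A$-weighted zero-sum sequence if $a_1x_1+\cdots+a_lx_l=0$ for some $a_i\in A$; subsequences are nonempty; $D_A(m)$ is the least $k$ such that every sequence of length $k$ in $\mathbb{Z}_m$ has an $A$-weighted zero-sum subsequence; an $A$-extremal sequence for the Davenport constant is a sequence of length $D_A(m)-1$ with no $A$-weighted zero-sum subsequence. If $A$ is a multiplicative group, sequences $(x_1,\ldots,x_k)$, $(y_1,\ldots,y_k)$ are equivalent with respect to $A$ if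 there are $a_i\in A$, a unit $c$ and a permutation $\sigma$ with $y_{\sigma(i)}=c\,a_ix_i$ for all $i$. For odd $m=\prod p_i^{r_i}$ and $a\in U(m)$, $\left(\frac{a}{m}\right)=\prod_i\left(\frac{a\bmod p_i}{p_i}\right)^{r_i}$, $\left(\frac{a}{p}\right)$ is the Legendre symbol of $a\bmod p$, and $L(m;p')=\{a\in U(m): \left(\frac{a}{m}\right)=\left(\frac{a}{p'}\right)\}$. -}

module Defs where

open import Data.Nat using (ℕ; zero; suc; _+_; _*_; _<_; _≟_)
open import Data.Nat.DivMod using (_%_)
open import Data.Nat.Coprimality using (Coprime)
open import Data.Integer as ℤ using (ℤ; +_; -[1+_])
open import Data.Bool using (Bool; true; false; if_then_else_)
open import Data.List using (List; []; _∷_; upTo)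
open import Data.Bool.ListAction using (any)
open import Data.Product using (Σ; ∃; _×_; _,_)
open import Data.Fin using (Fin; zero; suc)
open import Data.Fin.Subset using (Subset; Nonempty; _∈_; inside; outside)
open import Data.Fin.Permutation using (Permutation′; _⟨$⟩ʳ_)
open import Data.Vec using (_∷_; [])
open import Relation.Binary.PropositionalEquality using (_≡_)
open import Relation.Nullary using (¬_)
open import Relation.Nullary.Decidable using (⌊_⌋)

-- Elements of ℤ_m are represented by natural numbers; two naturals
-- represent the same element of ℤ_m iff they are congruent mod m.
-- Reduction mod m (with x mod 0 = x, never used for m = 0 below).
_mod′_ : ℕ → ℕ → ℕ
x mod′ zero = x
x mod′ suc k = x % suc k

infix 4 _≡_[mod_]
_≡_[mod_] : ℕ → ℕ → ℕ → Set
a ≡ b [mod m ] = a mod′ m ≡ b mod′ m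

Unit : ℕ → ℕ → Set
Unit m a = Coprime a m

InQ : ℕ → ℕ → Set
InQ q b = ∃ λ x → Unit q x × (x * x ≡ b [mod q ])

isSquareMod : ℕ → ℕ → Bool
isSquareMod p a = any (λ x → ⌊ (x * x) mod′ p ≟ a mod′ p ⌋) (upTo p)

legendre : ℕ → ℕ → ℤ
legendre p a with a mod′ p
... | zero = + 0
... | suc _ = if isSquareMod p a then + 1 else -[1+ 0 ]

-- Jacobi-type symbol (a/m) = ∏ (a/p_i)^{r_i}, given the prime
-- factorisation m = ∏ p_i^{r_i} as a list of pairs (p_i , r_i).
jacobi : List (ℕ × ℕ) → ℕ → ℤ
jacobi [] a = + 1
jacobi ((p , r) ∷ fs) a = (legendre p a ℤ.^ r) ℤ.* jacobi fs a

InL : List (ℕ × ℕ) → ℕ → ℕ → ℕ → Set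
InL fs m p' a = Unit m a × (jacobi fs a ≡ legendre p' a)

sumOver : ∀ {l} → Subset l → (Fin l → ℕ) → ℕ
sumOver [] f = 0
sumOver (true ∷ I) f = f zero + sumOver I (λ i → f (suc i))
sumOver (false ∷ I) f = sumOver I (λ i → f (suc i))

Seq : ℕ → Set
Seq l = Fin l → ℕ

HasWZS : (A : ℕ → Set) (m : ℕ) {l : ℕ} → Seq l → Set
HasWZS A m {l} x =
  Σ (Subset l) λ I → Nonempty I ×
    (Σ (Fin l → ℕ) λ a → (∀ i → i ∈ I → A (a i)) ×
       (sumOver I (λ i → a i * x i) ≡ 0 [mod m ]))

AllHaveWZS : (A : ℕ → Set) (m k : ℕ) → Set
AllHaveWZS A m k = (x : Seq k) → HasWZS A m x

DavenportIs : (A : ℕ → Set) (m k : ℕ) → Set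
DavenportIs A m k = AllHaveWZS A m k × (∀ k′ → k′ < k → ¬ AllHaveWZS A m k′)

Extremal : (A : ℕ → Set) (m : ℕ) {l : ℕ} → Seq l → Set
Extremal A m {l} x = DavenportIs A m (suc l) × ¬ HasWZS A m x

Equivalent : (A : ℕ → Set) (m : ℕ) {k : ℕ} → Seq k → Seq k → Set
Equivalent A m {k} x y =
  Σ (Fin k → ℕ) λ a → (∀ i → A (a i)) ×
    (Σ ℕ λ c → Unit m c ×
      (Σ (Permutation′ k) λ σ → ∀ i → y (σ ⟨$⟩ʳ i) ≡ c * a i * x i [mod m ]))

{-# OPTIONS --safe #-}
module Submission where

-- By the Chinese remainder theorem the weights in L(p′q; p′) are the residues that are units
-- mod p′ and squares mod q, so an L-weighted zero sum mod p′q is a support carrying both a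
-- U(p′)-weighted zero sum mod p′ and a Q_q-weighted zero sum mod q. For p′ ≥ 3 a support
-- admits the former unless it contains exactly one unit mod p′. Given D_{Q_q}(q) = 3, among
-- any four terms a Q_q-weighted zero sum of three of them (after merging two units mod p′, or
-- adjoining a term divisible by q) can be given such a support, so D_L(p′q) = 4. An
-- equivalence turns an L-weighted zero sum of x into a U(p′)·Q_q-weighted one of y; reduced
-- mod q it becomes a Q_q-weighted zero sum of (y₂, y₃), except in the cases that (i) and (ii)
-- rule out modulo p′.

open import Defs
open import Data.Nat using (ℕ; _*_; _≤_)
open import Data.Nat.Divisibility using (_∣_)
open import Data.Nat.Coprimality using (Coprime)
open import Data.Nat.Primality using (Prime)
open import Data.Fin using (zero; suc)
open import Data.List using ([]; _∷_)
open import Data.Product using (_×_; _,_)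
open import Data.Sum using (_⊎_)
open import Relation.Binary.PropositionalEquality using (_≢_)
open import Relation.Nullary using (¬_)

open import Data.Bool using (Bool; true; false; not; if_then_else_; T)
import Data.Bool.Properties as Bool
open import Data.Bool.ListAction using (any)
open import Data.Empty using (⊥-elim)
open import Data.Fin using (Fin; punchIn)
open import Data.Fin.Patterns using (0F; 1F; 2F; 3F)
open import Data.Fin.Permutation using (Permutation′; _⟨$⟩ʳ_; _⟨$⟩ˡ_; inverseˡ; transpose; _∘ₚ_)
open import Data.Fin.Properties using (any?)
open import Data.Fin.Subset using (Subset; _∈_)
open import Data.Integer as ℤ using (ℤ; 1ℤ; -1ℤ)
import Data.Integer.Properties as ℤ
open import Data.List using (upTo)
import Data.List.Membership.Propositional as List
open import Data.List.Membership.Propositional.Properties using (∈-upTo⁺)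
open import Data.List.Relation.Unary.Any as Any using (satisfied)
open import Data.List.Relation.Unary.Any.Properties using (any⁺; any⁻)
open import Data.Nat using (zero; suc; _+_; _<_; _≤′_; ≤′-refl; ≤′-step; s≤s; z≤n; NonZero; _≟_)
open import Data.Nat.Coprimality using (1-coprimeTo; coprime-Bézout; coprime-divisor)
import Data.Nat.Coprimality as Coprime
open import Data.Nat.Divisibility
  using ( divides; _∣?_; ∣-refl; ∣-trans; _∣0; 0∣⇒≡0; ∣1⇒≡1; ∣⇒≤; *-monoˡ-∣; ∣m∣n⇒∣m+n; ∣m+n∣m⇒∣n
        ; ∣n⇒∣m*n; ∣m⇒∣m*n; m∣m*n; n∣m*n; m%n≡0⇒n∣m; n∣m⇒m%n≡0)
open import Data.Nat.DivMod using (_%_; %-distribˡ-+; %-distribˡ-*; m%n%n≡m%n; m%n<n)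
open import Data.Nat.GCD using (module Bézout)
open import Data.Nat.Primality using (prime⇒nonZero; euclidsLemma; prime⇒irreducible; ¬prime[1])
open import Data.Nat.Properties
  using ( +-comm; +-identityʳ; *-comm; *-zeroʳ; 0≢1+n; suc-injective; <⇒≱; ≤-refl; ≤-trans; ≤⇒≤′
        ; *-1-commutativeMonoid; +-*-semiring)
open import Data.Nat.Tactic.RingSolver using (solve-∀)
open import Data.Product using (Σ; ∃; proj₁; proj₂)
open import Data.Sum using (inj₁; inj₂; [_,_])
open import Data.Vec using ([]; _∷_; lookup; tabulate; there)
open import Data.Vec.Functional using (removeAt; tail) renaming (_∷_ to _∷ᶠ_)
open import Data.Vec.Properties using ([]=⇒lookup; lookup⇒[]=; lookup∘tabulate)
open import Function using (_∘_)
open import Relation.Binary.PropositionalEquality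
  using (_≡_; refl; sym; trans; cong; cong₂; subst; subst₂; module ≡-Reasoning)
open import Relation.Nullary using (yes; no; does)
open import Relation.Nullary.Decidable using (⌊_⌋; dec-true; dec-false; toWitness; fromWitness)

open import Algebra.Properties.Semiring.Sum +-*-semiring
  using (sum; sum-cong-≗; sum-permute; *-distribˡ-sum)
open import Algebra.Properties.CommutativeMonoid.Sum *-1-commutativeMonoid
  using () renaming (sum to product; sum-remove to product-remove)

+-cong-mod : ∀ {m a b c d} → a ≡ b [mod m ] → c ≡ d [mod m ] → a + c ≡ b + d [mod m ]
+-cong-mod {zero} a≡b c≡d = cong₂ _+_ a≡b c≡d
+-cong-mod {suc k} {a} {b} {c} {d} a≡b c≡d = begin
  (a + c) % suc k                  ≡⟨ %-distribˡ-+ a c (suc k) ⟩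
  (a % suc k + c % suc k) % suc k  ≡⟨ cong₂ (λ u v → (u + v) % suc k) a≡b c≡d ⟩
  (b % suc k + d % suc k) % suc k  ≡⟨ %-distribˡ-+ b d (suc k) ⟨
  (b + d) % suc k                  ∎
  where open ≡-Reasoning

*-cong-mod : ∀ {m a b c d} → a ≡ b [mod m ] → c ≡ d [mod m ] → a * c ≡ b * d [mod m ]
*-cong-mod {zero} a≡b c≡d = cong₂ _*_ a≡b c≡d
*-cong-mod {suc k} {a} {b} {c} {d} a≡b c≡d = begin
  (a * c) % suc k                    ≡⟨ %-distribˡ-* a c (suc k) ⟩
  (a % suc k * (c % suc k)) % suc k  ≡⟨ cong₂ (λ u v → (u * v) % suc k) a≡b c≡d ⟩
  (b % suc k * (d % suc k)) % suc k  ≡⟨ %-distribˡ-* b d (suc k) ⟨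
  (b * d) % suc k                    ∎
  where open ≡-Reasoning

∣⇒≡0-mod : ∀ {m a} → m ∣ a → a ≡ 0 [mod m ]
∣⇒≡0-mod {zero}  0∣a = 0∣⇒≡0 0∣a
∣⇒≡0-mod {suc k} {a} m∣a = n∣m⇒m%n≡0 a (suc k) m∣a

≡0-mod⇒∣ : ∀ {m a} → a ≡ 0 [mod m ] → m ∣ a
≡0-mod⇒∣ {zero}  refl = ∣-refl
≡0-mod⇒∣ {suc k} {a} a≡0 = m%n≡0⇒n∣m a (suc k) a≡0

∣-resp-≡mod : ∀ {m a b} → a ≡ b [mod m ] → m ∣ a → m ∣ b
∣-resp-≡mod a≡b m∣a = ≡0-mod⇒∣ (trans (sym a≡b) (∣⇒≡0-mod m∣a))

≡-mod-+-∣ : ∀ {m} a {b} → m ∣ b → a + b ≡ a [mod m ]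
≡-mod-+-∣ {m} a {b} m∣b =
  trans (+-cong-mod {m} {a} {a} {b} {0} refl (∣⇒≡0-mod m∣b)) (cong (_mod′ m) (+-identityʳ a))

0-mod′ : ∀ r → 0 mod′ r ≡ 0
0-mod′ zero    = refl
0-mod′ (suc _) = refl

idempotent : ∀ {m n} → Coprime m n → ∃ λ e → e ≡ 0 [mod m ] × e ≡ 1 [mod n ]
idempotent {m} {zero} m⊥0 with m⊥0 (∣-refl , m ∣0)
... | refl = 1 , refl , refl
idempotent {m} {suc k} m⊥n with coprime-Bézout m⊥n
... | Bézout.+- x y 1+yn≡xm =
  x * m , ∣⇒≡0-mod {m} (n∣m*n x) , trans (cong (_mod′ suc k) (sym 1+yn≡xm)) (≡-mod-+-∣ {suc k} 1 (n∣m*n y))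
... | Bézout.-+ x y 1+xm≡yn = k * (x * m) , ∣⇒≡0-mod {m} (∣n⇒∣m*n k (n∣m*n x)) , e≡1
  where
  open ≡-Reasoning
  shift : ∀ k u → k * u + suc k ≡ 1 + k * (1 + u)
  shift = solve-∀
  e≡1 : k * (x * m) ≡ 1 [mod suc k ]
  e≡1 = begin
    (k * (x * m)) mod′ suc k                ≡⟨ ≡-mod-+-∣ {suc k} (k * (x * m)) ∣-refl ⟨
    (k * (x * m) + suc k) mod′ suc k
      ≡⟨ cong (_mod′ suc k) (trans (shift k (x * m)) (cong (λ t → 1 + k * t) 1+xm≡yn)) ⟩
    (1 + k * (y * suc k)) mod′ suc k        ≡⟨ ≡-mod-+-∣ {suc k} 1 (∣n⇒∣m*n k (n∣m*n y)) ⟩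
    1 mod′ suc k                            ∎

crt : ∀ {m n} → Coprime m n → ∀ a b → ∃ λ c → c ≡ a [mod m ] × c ≡ b [mod n ]
crt {m} {n} m⊥n a b with idempotent (Coprime.sym m⊥n) | idempotent m⊥n
... | eₘ , eₘ≡0 , eₘ≡1 | eₙ , eₙ≡0 , eₙ≡1 =
  a * eₘ + b * eₙ , combine {m} a b eₘ≡1 eₙ≡0 ,
  trans (cong (_mod′ n) (+-comm (a * eₘ) (b * eₙ))) (combine {n} b a eₙ≡1 eₘ≡0)
  where
  combine : ∀ {r e f} a b → e ≡ 1 [mod r ] → f ≡ 0 [mod r ] → a * e + b * f ≡ a [mod r ]
  combine {r} {e} {f} a b e≡1 f≡0 =
    trans (+-cong-mod {r} {a * e} {a * 1} {b * f} {b * 0}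
             (*-cong-mod {r} {a} {a} {e} {1} refl e≡1) (*-cong-mod {r} {b} {b} {f} {0} refl f≡0))
          (cong (_mod′ r) (a*1+b*0≡a a b))
    where
    a*1+b*0≡a : ∀ a b → a * 1 + b * 0 ≡ a
    a*1+b*0≡a = solve-∀

-- Weighted zero sums

selectedSum : ∀ {l} → (Fin l → Bool) → (Fin l → ℕ) → ℕ
selectedSum b t = sum λ i → if b i then t i else 0

selectedSum-cong : ∀ {l} {b : Fin l → Bool} {t u : Fin l → ℕ} →
  (∀ i → b i ≡ true → t i ≡ u i) → selectedSum b t ≡ selectedSum b u
selectedSum-cong {b = b} t≗u = sum-cong-≗ λ i → if-cong (b i) (t≗u i)
  where
  if-cong : ∀ c {v w} → (c ≡ true → v ≡ w) → (if c then v else 0) ≡ (if c then w else 0)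
  if-cong true  v≡w = v≡w refl
  if-cong false _   = refl

selectedSum-cong-mod : ∀ {m l} {b : Fin l → Bool} {t u : Fin l → ℕ} →
  (∀ i → b i ≡ true → t i ≡ u i [mod m ]) → selectedSum b t ≡ selectedSum b u [mod m ]
selectedSum-cong-mod {l = zero} _ = refl
selectedSum-cong-mod {m} {suc l} {b} {t} {u} t≗u =
  +-cong-mod {m} {if b zero then t zero else 0} {if b zero then u zero else 0}
    {selectedSum (λ i → b (suc i)) (λ i → t (suc i))} {selectedSum (λ i → b (suc i)) (λ i → u (suc i))}
    (head (b zero) (t≗u zero)) (selectedSum-cong-mod {m} (λ i → t≗u (suc i)))
  where
  head : ∀ c → (c ≡ true → t zero ≡ u zero [mod m ]) →
    (if c then t zero else 0) ≡ (if c then u zero else 0) [mod m ]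
  head true  t≡u = t≡u refl
  head false _   = refl

∣-selectedSum-resp : ∀ {m l} {b : Fin l → Bool} {t u : Fin l → ℕ} →
  (∀ i → b i ≡ true → t i ≡ u i [mod m ]) → m ∣ selectedSum b t → m ∣ selectedSum b u
∣-selectedSum-resp {m} {b = b} {t} {u} t≗u =
  ∣-resp-≡mod {b = selectedSum b u} (selectedSum-cong-mod {m} {b = b} {t} {u} t≗u)

selectedSum-zero : ∀ {l} (b : Fin l → Bool) → selectedSum b (λ _ → 0) ≡ 0
selectedSum-zero {zero}  b = refl
selectedSum-zero {suc l} b with b zero
... | true  = selectedSum-zero (λ i → b (suc i))
... | false = selectedSum-zero (λ i → b (suc i))

∣-selectedSum : ∀ {m l} {b : Fin l → Bool} {t : Fin l → ℕ} → (∀ i → b i ≡ true → m ∣ t i) → m ∣ selectedSum b t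
∣-selectedSum {m} {zero} _ = m ∣0
∣-selectedSum {m} {suc l} {b} m∣t = ∣m∣n⇒∣m+n (head (b zero) (m∣t zero)) (∣-selectedSum (λ i → m∣t (suc i)))
  where
  head : ∀ {v} c → (c ≡ true → m ∣ v) → m ∣ (if c then v else 0)
  head true  m∣v = m∣v refl
  head false _   = m ∣0

selectedSum-none : ∀ {l} {b : Fin l → Bool} t → (∀ i → b i ≢ true) → selectedSum b t ≡ 0
selectedSum-none {b = b} t unselected =
  trans (selectedSum-cong (λ i bᵢ → ⊥-elim (unselected i bᵢ))) (selectedSum-zero b)

selectedSum-*ˡ : ∀ {l} k (b : Fin l → Bool) t → selectedSum b (λ i → k * t i) ≡ k * selectedSum b t
selectedSum-*ˡ k b t =
  trans (sum-cong-≗ λ i → if-*ˡ (b i)) (sym (*-distribˡ-sum k (λ i → if b i then t i else 0)))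
  where
  if-*ˡ : ∀ c {v} → (if c then k * v else 0) ≡ k * (if c then v else 0)
  if-*ˡ true  = refl
  if-*ˡ false = sym (*-zeroʳ k)

selectedCount : ∀ {l} → (Fin l → Bool) → ℕ
selectedCount b = selectedSum b (λ _ → 1)

selectedCount≡0⇒selectedSum≡0 : ∀ {l} (b : Fin l → Bool) t → selectedCount b ≡ 0 → selectedSum b t ≡ 0
selectedCount≡0⇒selectedSum≡0 {zero}  b t _ = refl
selectedCount≡0⇒selectedSum≡0 {suc l} b t count≡0 with b zero
... | false = selectedCount≡0⇒selectedSum≡0 (λ i → b (suc i)) (λ i → t (suc i)) count≡0

sumOver≡selectedSum : ∀ {l} (I : Subset l) f → sumOver I f ≡ selectedSum (lookup I) f
sumOver≡selectedSum []          f = refl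
sumOver≡selectedSum (true ∷ I)  f = cong (f zero +_) (sumOver≡selectedSum I _)
sumOver≡selectedSum (false ∷ I) f = sumOver≡selectedSum I _

record ZeroSum (P : ℕ → Set) (m : ℕ) {l : ℕ} (x : Seq l) : Set where
  constructor zeroSum
  field
    support  : Fin l → Bool
    nonempty : ∃ λ i → support i ≡ true
    weight   : Fin l → ℕ
    weight∈P : ∀ i → support i ≡ true → P (weight i)
    vanishes : m ∣ selectedSum support (λ i → weight i * x i)

hasWZS⇒zeroSum : ∀ {P m l} {x : Seq l} → HasWZS P m x → ZeroSum P m x
hasWZS⇒zeroSum {m = m} (I , (i , i∈I) , a , a∈P , Σ≡0) =
  zeroSum (lookup I) (i , []=⇒lookup i∈I) a (λ j j∈I → a∈P j (lookup⇒[]= j I j∈I))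
    (≡0-mod⇒∣ (subst (λ s → s ≡ 0 [mod m ]) (sumOver≡selectedSum I _) Σ≡0))

zeroSum⇒hasWZS : ∀ {P m l} {x : Seq l} → ZeroSum P m x → HasWZS P m x
zeroSum⇒hasWZS {m = m} {x = x} (zeroSum b (i , bᵢ) a a∈P m∣Σ) =
  tabulate b , (i , lookup⇒[]= i (tabulate b) (trans (lookup∘tabulate b i) bᵢ)) , a ,
  (λ j j∈I → a∈P j (trans (sym (lookup∘tabulate b j)) ([]=⇒lookup j∈I))) ,
  subst (λ s → s ≡ 0 [mod m ]) (sym Σ≡) (∣⇒≡0-mod m∣Σ)
  where
  Σ≡ : sumOver (tabulate b) (λ j → a j * x j) ≡ selectedSum b (λ j → a j * x j)
  Σ≡ = trans (sumOver≡selectedSum (tabulate b) _)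
         (sum-cong-≗ λ j → cong (λ c → if c then a j * x j else 0) (lookup∘tabulate b j))

hasWZS-tail : ∀ {P m l} (x : Seq (suc l)) → HasWZS P m (λ i → x (suc i)) → HasWZS P m x
hasWZS-tail {P} x (I , (i , i∈I) , a , a∈P , Σ≡0) = false ∷ I , (suc i , there i∈I) , 0 ∷ᶠ a , a∈P′ , Σ≡0
  where
  a∈P′ : ∀ j → j ∈ false ∷ I → P ((0 ∷ᶠ a) j)
  a∈P′ (suc j) (there j∈I) = a∈P j j∈I

allHaveWZS-suc : ∀ {P m k} → AllHaveWZS P m k → AllHaveWZS P m (suc k)
allHaveWZS-suc {P} {m} all x = hasWZS-tail {P} {m} x (all (λ i → x (suc i)))

allHaveWZS-mono : ∀ {P m k l} → k ≤ l → AllHaveWZS P m k → AllHaveWZS P m l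
allHaveWZS-mono {P} {m} k≤l = go (≤⇒≤′ k≤l)
  where
  go : ∀ {k l} → k ≤′ l → AllHaveWZS P m k → AllHaveWZS P m l
  go ≤′-refl        all = all
  go (≤′-step k≤′l) all = allHaveWZS-suc {P} {m} (go k≤′l all)

extremal : ∀ {P m l} {x : Seq l} → AllHaveWZS P m (suc l) → ¬ HasWZS P m x → Extremal P m x
extremal {P} {m} {l} {x} all ¬zs = (all , lower) , ¬zs
  where
  lower : ∀ k → k < suc l → ¬ AllHaveWZS P m k
  lower k (s≤s k≤l) allₖ = ¬zs (allHaveWZS-mono {P} {m} k≤l allₖ x)

zeroSum-permute : ∀ {P m l} {x : Seq l} (σ : Permutation′ l) →
  ZeroSum P m (λ i → x (σ ⟨$⟩ʳ i)) → ZeroSum P m x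
zeroSum-permute {m = m} {x = x} σ (zeroSum b (i , bᵢ) a a∈P m∣Σ) =
  zeroSum (λ j → b (σ ⟨$⟩ˡ j)) (σ ⟨$⟩ʳ i , trans (cong b (inverseˡ σ)) bᵢ)
    (λ j → a (σ ⟨$⟩ˡ j)) (λ j → a∈P (σ ⟨$⟩ˡ j)) (subst (m ∣_) Σ≡ m∣Σ)
  where
  Σ≡ : selectedSum b (λ i → a i * x (σ ⟨$⟩ʳ i)) ≡ selectedSum (λ j → b (σ ⟨$⟩ˡ j)) (λ j → a (σ ⟨$⟩ˡ j) * x j)
  Σ≡ = sym (trans (sum-permute _ σ)
         (sum-cong-≗ λ i → cong (λ j → if b j then a j * x (σ ⟨$⟩ʳ i) else 0) (inverseˡ σ)))

zeroSum-map : ∀ {P Q m d l} {x : Seq l} → (∀ {a} → P a → Q a) → d ∣ m → ZeroSum P m x → ZeroSum Q d x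
zeroSum-map P⊆Q d∣m (zeroSum b ne a a∈P m∣Σ) = zeroSum b ne a (λ i bᵢ → P⊆Q (a∈P i bᵢ)) (∣-trans d∣m m∣Σ)

zeroSum-tail : ∀ {P m l} {x : Seq (suc l)} (Z : ZeroSum P m x) → let open ZeroSum Z in
  m ∣ (if support zero then weight zero * x zero else 0) →
  (∃ λ i → support (suc i) ≡ true) → ZeroSum P m (λ i → x (suc i))
zeroSum-tail (zeroSum b _ a a∈P m∣Σ) m∣head ne =
  zeroSum (λ i → b (suc i)) ne (λ i → a (suc i)) (λ i → a∈P (suc i)) (∣m+n∣m⇒∣n m∣Σ m∣head)

zeroSum-head : ∀ {P m l} {x : Seq (suc l)} → P 1 → m ∣ x zero → ZeroSum P m x
zeroSum-head {m = m} {l} P1 m∣x₀ =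
  zeroSum (true ∷ᶠ λ _ → false) (zero , refl) (λ _ → 1) (λ { zero _ → P1 ; (suc _) () })
    (∣m∣n⇒∣m+n (∣n⇒∣m*n 1 m∣x₀) (subst (m ∣_) (sym (selectedSum-zero {l} (λ _ → false))) (m ∣0)))

product-closed : ∀ {W : ℕ → Set} → W 1 → (∀ {a b} → W a → W b → W (a * b)) →
  ∀ {l} (g : Fin l → ℕ) → (∀ i → W (g i)) → W (product g)
product-closed W1 W* {zero}  g g∈W = W1
product-closed {W} W1 W* {suc l} g g∈W =
  W* (g∈W zero) (product-closed {W} W1 W* (λ i → g (suc i)) (λ i → g∈W (suc i)))

cofactor : ∀ {l} → (Fin (suc l) → ℕ) → Fin (suc l) → ℕ
cofactor g i = product (removeAt g i)

cofactor-* : ∀ {l} (g : Fin (suc l) → ℕ) i → cofactor g i * g i ≡ product g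
cofactor-* g i = trans (*-comm (cofactor g i) (g i)) (sym (product-remove {i = i} g))

module _ {A W : ℕ → Set} (A⊆W : ∀ {a} → A a → W a) (W1 : W 1) (W* : ∀ {a b} → W a → W b → W (a * b)) where

  -- Multiplying the i-th weight by the product of the other scalars g_j makes every
  -- term carry the same factor c ∏ g, so the zero sum survives without inverting g.
  zeroSum-transport : ∀ {m l} {x y : Seq l} → Equivalent A m x y → ZeroSum A m x → ZeroSum W m y
  zeroSum-transport {l = zero} _ (zeroSum _ (() , _) _ _ _)
  zeroSum-transport {m} {suc l} {x} {y} (g , g∈A , c , _ , σ , y≡cgx) (zeroSum b ne α α∈A m∣Σ) =
    zeroSum-permute σ (zeroSum b ne w w∈W m∣Σ′)
    where
    G = product g
    w : Fin (suc l) → ℕ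
    w i = α i * cofactor g i
    w∈W : ∀ i → b i ≡ true → W (w i)
    w∈W i bᵢ = W* (A⊆W (α∈A i bᵢ)) (product-closed {W} W1 W* (removeAt g i) (λ j → A⊆W (g∈A (punchIn i j))))
    regroup : ∀ i → c * G * (α i * x i) ≡ w i * (c * g i * x i)
    regroup i = begin
      c * G * (α i * x i)                        ≡⟨ cong (λ h → c * h * (α i * x i)) (cofactor-* g i) ⟨
      c * (cofactor g i * g i) * (α i * x i)     ≡⟨ shuffle c (cofactor g i) (g i) (α i) (x i) ⟩
      α i * cofactor g i * (c * g i * x i)       ∎
      where
      open ≡-Reasoning
      shuffle : ∀ c h gᵢ αᵢ xᵢ → c * (h * gᵢ) * (αᵢ * xᵢ) ≡ αᵢ * h * (c * gᵢ * xᵢ)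
      shuffle = solve-∀
    term≡ : ∀ i → b i ≡ true → c * G * (α i * x i) ≡ w i * y (σ ⟨$⟩ʳ i) [mod m ]
    term≡ i _ = trans (cong (_mod′ m) (regroup i))
      (*-cong-mod {m} {w i} {w i} {c * g i * x i} {y (σ ⟨$⟩ʳ i)} refl (sym (y≡cgx i)))
    m∣Σ′ : m ∣ selectedSum b (λ i → w i * y (σ ⟨$⟩ʳ i))
    m∣Σ′ = ∣-selectedSum-resp term≡
      (subst (m ∣_) (sym (selectedSum-*ˡ (c * G) b (λ i → α i * x i))) (∣n⇒∣m*n (c * G) m∣Σ))

-- Primes, quadratic residues and the Legendre symbol

module _ {p : ℕ} (p-prime : Prime p) where

  prime-∤-* : ∀ {a b} → ¬ p ∣ a → ¬ p ∣ b → ¬ p ∣ a * b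
  prime-∤-* {a} {b} p∤a p∤b p∣ab = [ p∤a , p∤b ] (euclidsLemma a b p-prime p∣ab)

  prime-∤⇒coprime : ∀ {a} → ¬ p ∣ a → Coprime a p
  prime-∤⇒coprime p∤a (d∣a , d∣p) with prime⇒irreducible p-prime d∣p
  ... | inj₁ d≡1 = d≡1
  ... | inj₂ refl = ⊥-elim (p∤a d∣a)

  coprime⇒prime-∤ : ∀ {a m} → Coprime a m → p ∣ m → ¬ p ∣ a
  coprime⇒prime-∤ a⊥m p∣m p∣a = ¬prime[1] (subst Prime (a⊥m (p∣a , p∣m)) p-prime)

  prime-∤1 : ¬ p ∣ 1
  prime-∤1 p∣1 = ¬prime[1] (subst Prime (∣1⇒≡1 p∣1) p-prime)

  ¬coprime⇒prime-∣ : ∀ {a} → ¬ Coprime a p → p ∣ a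
  ¬coprime⇒prime-∣ {a} ¬a⊥p with p ∣? a
  ... | yes p∣a = p∣a
  ... | no  p∤a = ⊥-elim (¬a⊥p (prime-∤⇒coprime p∤a))

  InQ-1 : InQ p 1
  InQ-1 = 1 , 1-coprimeTo p , refl

  InQ⇒∤ : ∀ {a} → InQ p a → ¬ p ∣ a
  InQ⇒∤ (z , z⊥p , z²≡a) p∣a =
    prime-∤-* p∤z p∤z (∣-resp-≡mod (sym z²≡a) p∣a)
    where p∤z = coprime⇒prime-∤ z⊥p ∣-refl

  InQ-* : ∀ {a b} → InQ p a → InQ p b → InQ p (a * b)
  InQ-* {a} {b} (z , z⊥p , z²≡a) (w , w⊥p , w²≡b) =
    z * w , prime-∤⇒coprime (prime-∤-* (coprime⇒prime-∤ z⊥p ∣-refl) (coprime⇒prime-∤ w⊥p ∣-refl)) ,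
    trans (cong (_mod′ p) (square-* z w)) (*-cong-mod {p} {z * z} {a} {w * w} {b} z²≡a w²≡b)
    where
    square-* : ∀ z w → z * w * (z * w) ≡ z * z * (w * w)
    square-* = solve-∀

sign : Bool → ℤ
sign s = if s then 1ℤ else -1ℤ

legendre-sign : ∀ {r a} → ¬ r ∣ a → legendre r a ≡ sign (isSquareMod r a)
legendre-sign {r} {a} r∤a = go refl
  where
  -- isSquareMod r a is squareResidue (a mod′ r); naming it keeps it out of the
  -- with-abstraction over a mod′ r that unfolds legendre.
  squareResidue : ℕ → Bool
  squareResidue t = any (λ z → ⌊ (z * z) mod′ r ≟ t ⌋) (upTo r)
  go : ∀ {s} → squareResidue (a mod′ r) ≡ s → legendre r a ≡ sign s
  go sq with a mod′ r in eq
  ... | zero  = ⊥-elim (r∤a (≡0-mod⇒∣ (trans eq (sym (0-mod′ r)))))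
  ... | suc _ = cong sign (subst (λ t → squareResidue t ≡ _) (sym eq) sq)

isSquareMod⇒square : ∀ {r a} → isSquareMod r a ≡ true → ∃ λ z → z * z ≡ a [mod r ]
isSquareMod⇒square {r} {a} sq with satisfied (any⁻ _ (upTo r) (subst T (sym sq) _))
... | z , z²≡a = z , toWitness z²≡a

square⇒isSquareMod : ∀ {r a} .{{_ : NonZero r}} z → z * z ≡ a [mod r ] → isSquareMod r a ≡ true
square⇒isSquareMod {suc k} {a} z z²≡a = T⇒≡true (any⁺ _ (Any.map (λ { refl → fromWitness z′²≡a }) z′∈))
  where
  z′ = z % suc k
  z′∈ : z′ List.∈ upTo (suc k)
  z′∈ = ∈-upTo⁺ (m%n<n z (suc k))
  z′²≡a : z′ * z′ ≡ a [mod suc k ]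
  z′²≡a = trans (*-cong-mod {suc k} {z′} {z} {z′} {z} (m%n%n≡m%n z (suc k)) (m%n%n≡m%n z (suc k))) z²≡a
  T⇒≡true : ∀ {s} → T s → s ≡ true
  T⇒≡true {true} _ = refl

sign-cancel : ∀ s t → sign s ℤ.^ 1 ℤ.* (sign t ℤ.^ 1 ℤ.* 1ℤ) ≡ sign s → t ≡ true
sign-cancel s     true  _ = refl
sign-cancel true  false ()
sign-cancel false false ()

module _ {q : ℕ} (q-prime : Prime q) where

  zeroSum-of-units-not-singleton : ∀ {l} {x : Seq l} → (∀ i → ¬ q ∣ x i) →
    (Z : ZeroSum (InQ q) q x) → selectedCount (ZeroSum.support Z) ≢ 1
  zeroSum-of-units-not-singleton {x = x} q∤x (zeroSum b _ β β∈Q q∣Σ) = go x b β q∤x β∈Q q∣Σ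
    where
    go : ∀ {l} (x : Seq l) b β → (∀ i → ¬ q ∣ x i) → (∀ i → b i ≡ true → InQ q (β i)) →
      q ∣ selectedSum b (λ i → β i * x i) → selectedCount b ≢ 1
    go {zero}  x b β q∤x β∈Q q∣Σ ()
    go {suc l} x b β q∤x β∈Q q∣Σ count≡1 with b zero in b₀
    ... | false = go (λ i → x (suc i)) (λ i → b (suc i)) (λ i → β (suc i)) (λ i → q∤x (suc i))
                    (λ i → β∈Q (suc i)) q∣Σ count≡1
    ... | true  = prime-∤-* q-prime (InQ⇒∤ q-prime (β∈Q zero b₀)) (q∤x zero)
                    (subst (q ∣_) (trans (cong (β zero * x zero +_) tail≡0) (+-identityʳ (β zero * x zero))) q∣Σ)
      where
      tail≡0 : selectedSum (λ i → b (suc i)) (λ i → β (suc i) * x (suc i)) ≡ 0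
      tail≡0 = selectedCount≡0⇒selectedSum≡0 {l} (λ i → b (suc i)) (λ i → β (suc i) * x (suc i))
                 (suc-injective count≡1)

-- Unit-weighted zero sums modulo a prime p = k + 2 ≥ 3

module UnitWeights (k : ℕ) (1≤k : 1 ≤ k) (p-prime : Prime (suc (suc k))) where

  private
    p : ℕ
    p = suc (suc k)

  ∤-small : ∀ {a} → .{{NonZero a}} → a < p → ¬ p ∣ a
  ∤-small a<p p∣a = <⇒≱ a<p (∣⇒≤ p∣a)

  isUnit : ℕ → Bool
  isUnit a = not (does (p ∣? a))

  isUnit-true : ∀ {a} → ¬ p ∣ a → isUnit a ≡ true
  isUnit-true {a} p∤a = cong not (dec-false (p ∣? a) p∤a)

  isUnit-false : ∀ {a} → p ∣ a → isUnit a ≡ false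
  isUnit-false {a} p∣a = cong not (dec-true (p ∣? a) p∣a)

  unitCount : ∀ {l} → Seq l → (Fin l → Bool) → ℕ
  unitCount x b = selectedSum b (λ i → if isUnit (x i) then 1 else 0)

  Solvable : ∀ {l} → Seq l → (Fin l → Bool) → Set
  Solvable {l} x b = Σ (Fin l → ℕ) λ α → (∀ i → b i ≡ true → ¬ p ∣ α i) × p ∣ selectedSum b (λ i → α i * x i)

  Absorbs : ∀ {l} → Seq l → (Fin l → Bool) → Set
  Absorbs x b = ∀ {u} → ¬ p ∣ u → Solvable (u ∷ᶠ x) (true ∷ᶠ b)

  unitCount-units : ∀ {l} {x : Seq l} b → (∀ i → ¬ p ∣ x i) → unitCount x b ≡ selectedCount b
  unitCount-units b p∤x = selectedSum-cong λ i _ → cong (λ c → if c then 1 else 0) (isUnit-true (p∤x i))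

  unitCount-nonunits : ∀ {l} {x : Seq l} b → (∀ i → p ∣ x i) → unitCount x b ≡ 0
  unitCount-nonunits b p∣x =
    trans (selectedSum-cong λ i _ → cong (λ c → if c then 1 else 0) (isUnit-false (p∣x i))) (selectedSum-zero b)

  private
    units-∷ : ∀ {l} {b : Fin (suc l) → Bool} {a α} → (b zero ≡ true → ¬ p ∣ a) →
      (∀ i → b (suc i) ≡ true → ¬ p ∣ α i) → ∀ i → b i ≡ true → ¬ p ∣ (a ∷ᶠ α) i
    units-∷ p∤a p∤α zero    = p∤a
    units-∷ p∤a p∤α (suc i) = p∤α i

    p∤1 : ¬ p ∣ 1
    p∤1 = prime-∤1 p-prime

    p∤2 : ¬ p ∣ 2
    p∤2 = ∤-small (s≤s (s≤s 1≤k))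

    p∤p-1 : ¬ p ∣ suc k
    p∤p-1 = ∤-small ≤-refl

    ∤* : ∀ {a b} → ¬ p ∣ a → ¬ p ∣ b → ¬ p ∣ a * b
    ∤* = prime-∤-* p-prime

    unselected : ∀ {c a} → c ≡ false → c ≡ true → ¬ p ∣ a
    unselected refl ()

  count-unit : ∀ {a} → ¬ p ∣ a → ∀ c → (if isUnit a then 1 else 0) + c ≡ suc c
  count-unit p∤a c = cong (λ s → (if s then 1 else 0) + c) (isUnit-true p∤a)

  count-nonunit : ∀ {a} → p ∣ a → ∀ c → (if isUnit a then 1 else 0) + c ≡ c
  count-nonunit p∣a c = cong (λ s → (if s then 1 else 0) + c) (isUnit-false p∣a)

  -- Along the sequence, a unit still to be balanced is paired with the next selected unit v,
  -- via weights (v, (p - 1) u), or, if further units follow, merged with it into the unit u v,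
  -- via weights (2 a v, (p - 1) a u), which contribute a u v modulo p.
  solvable : ∀ {l} (x : Seq l) b → unitCount x b ≢ 1 → Solvable x b
  absorbs  : ∀ {l} (x : Seq l) b → unitCount x b ≢ 0 → Absorbs x b

  solvable {zero}  x b _ = (λ ()) , (λ ()) , (p ∣0)
  solvable {suc l} x b count≢1 with b zero in b₀ | p ∣? x zero
  ... | false | _ with solvable (tail x) (tail b) count≢1
  ...   | α , p∤α , p∣Σ = 1 ∷ᶠ α , units-∷ (unselected b₀) p∤α , p∣Σ
  solvable {suc l} x b count≢1 | true | yes p∣x₀
    with solvable (tail x) (tail b) (count≢1 ∘ trans (count-nonunit p∣x₀ _))
  ...   | α , p∤α , p∣Σ = 1 ∷ᶠ α , units-∷ (λ _ → p∤1) p∤α , ∣m∣n⇒∣m+n (∣n⇒∣m*n 1 p∣x₀) p∣Σ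
  solvable {suc l} x b count≢1 | true | no p∤x₀
    with absorbs (tail x) (tail b) (count≢1 ∘ trans (count-unit p∤x₀ _) ∘ cong suc) p∤x₀
  ...   | α , p∤α , p∣Σ = α , (λ { zero _ → p∤α zero refl ; (suc i) → p∤α (suc i) }) , p∣Σ

  absorbs {zero}  x b count≢0 = ⊥-elim (count≢0 refl)
  absorbs {suc l} x b count≢0 {u} p∤u with b zero in b₀ | p ∣? x zero
  ... | false | _ with absorbs (tail x) (tail b) count≢0 p∤u
  ...   | α , p∤α , p∣Σ = α zero ∷ᶠ 1 ∷ᶠ tail α ,
          units-∷ (λ _ → p∤α zero refl) (units-∷ (unselected b₀) (λ i → p∤α (suc i))) ,
          p∣Σ
  absorbs {suc l} x b count≢0 {u} p∤u | true | yes p∣x₀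
    with absorbs (tail x) (tail b) (count≢0 ∘ trans (count-nonunit p∣x₀ _)) p∤u
  ...   | α , p∤α , p∣Σ = α zero ∷ᶠ 1 ∷ᶠ tail α ,
          units-∷ (λ _ → p∤α zero refl) (units-∷ (λ _ → p∤1) (λ i → p∤α (suc i))) ,
          subst (p ∣_) (swap (α zero * u) (1 * x zero) _) (∣m∣n⇒∣m+n (∣n⇒∣m*n 1 p∣x₀) p∣Σ)
    where
    swap : ∀ a b c → b + (a + c) ≡ a + (b + c)
    swap = solve-∀
  absorbs {suc l} x b count≢0 {u} p∤u | true | no p∤x₀ with unitCount (tail x) (tail b) ≟ 0
  ... | yes count′≡0 with solvable (tail x) (tail b) (λ count′≡1 → 0≢1+n (trans (sym count′≡0) count′≡1))
  ...   | α , p∤α , p∣Σ = x zero ∷ᶠ suc k * u ∷ᶠ α ,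
          units-∷ (λ _ → p∤x₀) (units-∷ (λ _ → ∤* p∤p-1 p∤u) p∤α) ,
          subst (p ∣_) (sym (pair k u (x zero) _)) (∣m∣n⇒∣m+n (m∣m*n (u * x zero)) p∣Σ)
    where
    pair : ∀ k u v t → v * u + (suc k * u * v + t) ≡ suc (suc k) * (u * v) + t
    pair = solve-∀
  absorbs {suc l} x b count≢0 {u} p∤u | true | no p∤x₀ | no count′≢0
    with absorbs (tail x) (tail b) count′≢0 (∤* p∤u p∤x₀)
  ...   | α , p∤α , p∣Σ = 2 * α zero * x zero ∷ᶠ suc k * α zero * u ∷ᶠ tail α ,
          units-∷ (λ _ → ∤* (∤* p∤2 (p∤α zero refl)) p∤x₀)
            (units-∷ (λ _ → ∤* (∤* p∤p-1 (p∤α zero refl)) p∤u) (λ i → p∤α (suc i))) ,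
          subst (p ∣_) (sym (triple k (α zero) u (x zero) _)) (∣m∣n⇒∣m+n (m∣m*n (α zero * u * x zero)) p∣Σ)
    where
    triple : ∀ k a u v t → 2 * a * v * u + (suc k * a * u * v + t) ≡ suc (suc k) * (a * u * v) + (a * (u * v) + t)
    triple = solve-∀

-- The weights L(p q; p)

module TwoPrimes (k q : ℕ) (1≤k : 1 ≤ k) (p-prime : Prime (suc (suc k))) (q-prime : Prime q)
                 (p≢q : suc (suc k) ≢ q) where

  open UnitWeights k 1≤k p-prime

  p n : ℕ
  p = suc (suc k)
  n = p * q

  L : ℕ → Set
  L = InL ((p , 1) ∷ (q , 1) ∷ []) n p

  InUQ : ℕ → Set
  InUQ a = ¬ p ∣ a × InQ q a

  private
    instance
      q-nonZero : NonZero q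
      q-nonZero = prime⇒nonZero q-prime

  q∤p : ¬ q ∣ p
  q∤p q∣p with prime⇒irreducible p-prime q∣p
  ... | inj₁ q≡1 = ¬prime[1] (subst Prime q≡1 q-prime)
  ... | inj₂ q≡p = p≢q (sym q≡p)

  p∤q : ¬ p ∣ q
  p∤q p∣q with prime⇒irreducible q-prime p∣q
  ... | inj₁ ()
  ... | inj₂ p≡q = p≢q p≡q

  p∣∧q∣⇒n∣ : ∀ {a} → p ∣ a → q ∣ a → n ∣ a
  p∣∧q∣⇒n∣ {a} (divides j a≡jp) q∣a = subst₂ _∣_ (*-comm q p) (sym a≡jp) (*-monoˡ-∣ p q∣j)
    where
    q∣j : q ∣ j
    q∣j = coprime-divisor (prime-∤⇒coprime p-prime p∤q) (subst (q ∣_) (trans a≡jp (*-comm j p)) q∣a)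

  coprime-n : ∀ {a} → ¬ p ∣ a → ¬ q ∣ a → Coprime a n
  coprime-n p∤a q∤a {d} (d∣a , d∣n) with prime⇒irreducible q-prime (coprime-divisor d⊥p d∣n)
    where
    d⊥p : Coprime d p
    d⊥p = prime-∤⇒coprime p-prime (λ p∣d → p∤a (∣-trans p∣d d∣a))
  ... | inj₁ d≡1 = d≡1
  ... | inj₂ refl = ⊥-elim (q∤a d∣a)

  L⇒InUQ : ∀ {a} → L a → InUQ a
  L⇒InUQ {a} (a⊥n , jacobi≡legendre) = p∤a , a∈Q
    where
    p∤a = coprime⇒prime-∤ p-prime a⊥n (m∣m*n q)
    q∤a = coprime⇒prime-∤ q-prime a⊥n (n∣m*n p)
    a-square : isSquareMod q a ≡ true
    a-square = sign-cancel (isSquareMod p a) (isSquareMod q a)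
      (trans (cong₂ (λ s t → s ℤ.^ 1 ℤ.* (t ℤ.^ 1 ℤ.* 1ℤ)) (sym (legendre-sign p∤a)) (sym (legendre-sign q∤a)))
             (trans jacobi≡legendre (legendre-sign p∤a)))
    a∈Q : InQ q a
    a∈Q with isSquareMod⇒square {q} a-square
    ... | z , z²≡a =
      z , prime-∤⇒coprime q-prime (λ q∣z → q∤a (∣-resp-≡mod {q} {z * z} z²≡a (∣m⇒∣m*n z q∣z))) , z²≡a

  InUQ⇒L : ∀ {a} → InUQ a → L a
  InUQ⇒L {a} (p∤a , a∈Q@(z , _ , z²≡a)) = coprime-n p∤a q∤a , jacobi≡legendre
    where
    q∤a = InQ⇒∤ q-prime a∈Q
    open ≡-Reasoning
    jacobi≡legendre : legendre p a ℤ.^ 1 ℤ.* (legendre q a ℤ.^ 1 ℤ.* 1ℤ) ≡ legendre p a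
    jacobi≡legendre = begin
      legendre p a ℤ.^ 1 ℤ.* (legendre q a ℤ.^ 1 ℤ.* 1ℤ)
        ≡⟨ cong (λ t → legendre p a ℤ.^ 1 ℤ.* (t ℤ.^ 1 ℤ.* 1ℤ))
             (trans (legendre-sign q∤a) (cong sign (square⇒isSquareMod z z²≡a))) ⟩
      legendre p a ℤ.* 1ℤ ℤ.* 1ℤ
        ≡⟨ trans (ℤ.*-identityʳ _) (ℤ.*-identityʳ _) ⟩
      legendre p a ∎

  InUQ-1 : InUQ 1
  InUQ-1 = prime-∤1 p-prime , InQ-1 q-prime

  InUQ-* : ∀ {a b} → InUQ a → InUQ b → InUQ (a * b)
  InUQ-* (p∤a , a∈Q) (p∤b , b∈Q) = prime-∤-* p-prime p∤a p∤b , InQ-* q-prime a∈Q b∈Q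

  zeroSum-lift : ∀ {l} {x : Seq l} (Z : ZeroSum (InQ q) q x) → Solvable x (ZeroSum.support Z) → ZeroSum L n x
  zeroSum-lift {x = x} (zeroSum b ne β β∈Q q∣Σ) (α , p∤α , p∣Σ) = zeroSum b ne c c∈L (p∣∧q∣⇒n∣ p∣Σ′ q∣Σ′)
    where
    c : Fin _ → ℕ
    c i = proj₁ (crt (prime-∤⇒coprime q-prime q∤p) (α i) (β i))
    c≡α : ∀ i → c i ≡ α i [mod p ]
    c≡α i = proj₁ (proj₂ (crt (prime-∤⇒coprime q-prime q∤p) (α i) (β i)))
    c≡β : ∀ i → c i ≡ β i [mod q ]
    c≡β i = proj₂ (proj₂ (crt (prime-∤⇒coprime q-prime q∤p) (α i) (β i)))
    c∈L : ∀ i → b i ≡ true → L (c i)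
    c∈L i bᵢ with β∈Q i bᵢ
    ... | z , z⊥q , z²≡β = InUQ⇒L ((λ p∣c → p∤α i bᵢ (∣-resp-≡mod {p} {c i} (c≡α i) p∣c)) ,
                                 (z , z⊥q , trans z²≡β (sym (c≡β i))))
    p∣Σ′ : p ∣ selectedSum b (λ i → c i * x i)
    p∣Σ′ = ∣-selectedSum-resp {b = b} {λ i → α i * x i} {λ i → c i * x i}
             (λ i _ → *-cong-mod {p} {α i} {c i} {x i} {x i} (sym (c≡α i)) refl) p∣Σ
    q∣Σ′ : q ∣ selectedSum b (λ i → c i * x i)
    q∣Σ′ = ∣-selectedSum-resp {b = b} {λ i → β i * x i} {λ i → c i * x i}
             (λ i _ → *-cong-mod {q} {β i} {c i} {x i} {x i} (sym (c≡β i)) refl) q∣Σ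

  extend-by-q-multiple : ∀ {l} {x : Seq (suc l)} → q ∣ x zero → ¬ p ∣ x zero →
    ZeroSum (InQ q) q (tail x) → ZeroSum L n x
  extend-by-q-multiple {x = x} q∣x₀ p∤x₀ (zeroSum b (i , bᵢ) β β∈Q q∣Σ) with unitCount (tail x) b ≟ 0
  ... | yes count≡0 =
    zeroSum-lift (zeroSum (false ∷ᶠ b) (suc i , bᵢ) (1 ∷ᶠ β) (λ { (suc j) → β∈Q j }) q∣Σ)
         (solvable x (false ∷ᶠ b) (λ count≡1 → 0≢1+n (trans (sym count≡0) count≡1)))
  ... | no count≢0 =
    zeroSum-lift (zeroSum (true ∷ᶠ b) (zero , refl) (1 ∷ᶠ β) (λ { zero _ → InQ-1 q-prime ; (suc j) → β∈Q j })
                  (∣m∣n⇒∣m+n (∣n⇒∣m*n 1 q∣x₀) q∣Σ))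
         (solvable x (true ∷ᶠ b) (count≢0 ∘ suc-injective ∘ trans (sym (count-unit p∤x₀ _))))

  extend-uniform : ∀ {l} {x : Seq (suc l)} → (∀ i → ¬ p ∣ x (suc i)) ⊎ (∀ i → p ∣ x (suc i)) →
    (∀ i → ¬ q ∣ x (suc i)) → ZeroSum (InQ q) q (tail x) → ZeroSum L n x
  extend-uniform {x = x} uniform q∤xs Z@(zeroSum b (i , bᵢ) β β∈Q q∣Σ) =
    zeroSum-lift (zeroSum (false ∷ᶠ b) (suc i , bᵢ) (1 ∷ᶠ β) (λ { (suc j) → β∈Q j }) q∣Σ)
                 (solvable x (false ∷ᶠ b) count≢1)
    where
    count≢1 : unitCount (tail x) b ≢ 1
    count≢1 = [ (λ p∤xs → subst (_≢ 1) (sym (unitCount-units b p∤xs))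
                              (zeroSum-of-units-not-singleton q-prime q∤xs Z)) ,
                (λ p∣xs count≡1 → 0≢1+n (trans (sym (unitCount-nonunits b p∣xs)) count≡1)) ] uniform

  extend-merged : ∀ {l} {x : Seq (suc (suc l))} → ¬ p ∣ x zero → ¬ p ∣ x (suc zero) → (∀ i → p ∣ x (suc (suc i))) →
    ZeroSum (InQ q) q ((x zero + x (suc zero)) ∷ᶠ tail (tail x)) → ZeroSum L n x
  extend-merged {l} {x} p∤x₀ p∤x₁ p∣xs (zeroSum b (i , bᵢ) β β∈Q q∣Σ) =
    zeroSum-lift (zeroSum (b zero ∷ᶠ b) (suc i , bᵢ) (β zero ∷ᶠ β) (λ { zero → β∈Q zero ; (suc j) → β∈Q j })
                  (subst (q ∣_) (split (b zero)) q∣Σ))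
         (solvable x (b zero ∷ᶠ b) count≢1)
    where
    rest = selectedSum (tail b) (λ i → β (suc i) * x (suc (suc i)))
    split : ∀ s → (if s then β zero * (x zero + x (suc zero)) else 0) + rest ≡
                  (if s then β zero * x zero else 0) + ((if s then β zero * x (suc zero) else 0) + rest)
    split true  = distrib (β zero) (x zero) (x (suc zero)) rest
      where
      distrib : ∀ a u v r → a * (u + v) + r ≡ a * u + (a * v + r)
      distrib = solve-∀
    split false = refl
    count≢1 : unitCount x (b zero ∷ᶠ b) ≢ 1
    count≢1 rewrite isUnit-true p∤x₀ | isUnit-true p∤x₁ | unitCount-nonunits (tail b) p∣xs with b zero
    ... | true  = λ ()
    ... | false = λ ()

  module _ (Q-davenport : AllHaveWZS (InQ q) q 3) where

    private
      Q-zeroSum : (y : Seq 3) → ZeroSum (InQ q) q y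
      Q-zeroSum y = hasWZS⇒zeroSum (Q-davenport y)

      with-q-multiple : (x : Seq 4) → q ∣ x zero → ZeroSum L n x
      with-q-multiple x q∣x₀ with p ∣? x zero
      ... | yes p∣x₀ = zeroSum-head (InUQ⇒L InUQ-1) (p∣∧q∣⇒n∣ p∣x₀ q∣x₀)
      ... | no  p∤x₀ = extend-by-q-multiple q∣x₀ p∤x₀ (Q-zeroSum (tail x))

      uniform : {x : Seq 4} → (∀ i → ¬ p ∣ x (suc i)) ⊎ (∀ i → p ∣ x (suc i)) → (∀ i → ¬ q ∣ x i) → ZeroSum L n x
      uniform {x} status q∤x = extend-uniform status (λ i → q∤x (suc i)) (Q-zeroSum (tail x))

      merged : {x : Seq 4} → ¬ p ∣ x 0F → ¬ p ∣ x 1F → p ∣ x 2F → p ∣ x 3F → ZeroSum L n x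
      merged p∤x₀ p∤x₁ p∣x₂ p∣x₃ = extend-merged p∤x₀ p∤x₁ (λ { 0F → p∣x₂ ; 1F → p∣x₃ }) (Q-zeroSum _)

      all₃ : ∀ {P : Fin 3 → Set} → P 0F → P 1F → P 2F → ∀ i → P i
      all₃ P₀ P₁ P₂ 0F = P₀
      all₃ P₀ P₁ P₂ 1F = P₁
      all₃ P₀ P₁ P₂ 2F = P₂

      q-units : (x : Seq 4) → (∀ i → ¬ q ∣ x i) → ZeroSum L n x
      q-units x q∤x with p ∣? x 0F | p ∣? x 1F | p ∣? x 2F | p ∣? x 3F
      ... | _     | no b  | no c  | no d  = uniform (inj₁ (all₃ b c d)) q∤x
      ... | _     | yes b | yes c | yes d = uniform (inj₂ (all₃ b c d)) q∤x
      ... | no a  | yes b | no c  | no d  = zeroSum-permute (transpose 0F 1F) (uniform (inj₁ (all₃ a c d)) (q∤x ∘ _))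
      ... | yes a | no b  | yes c | yes d = zeroSum-permute (transpose 0F 1F) (uniform (inj₂ (all₃ a c d)) (q∤x ∘ _))
      ... | no a  | no b  | yes c | no d  = zeroSum-permute (transpose 0F 2F) (uniform (inj₁ (all₃ b a d)) (q∤x ∘ _))
      ... | yes a | yes b | no c  | yes d = zeroSum-permute (transpose 0F 2F) (uniform (inj₂ (all₃ b a d)) (q∤x ∘ _))
      ... | no a  | no b  | no c  | yes d = zeroSum-permute (transpose 0F 3F) (uniform (inj₁ (all₃ b c a)) (q∤x ∘ _))
      ... | yes a | yes b | yes c | no d  = zeroSum-permute (transpose 0F 3F) (uniform (inj₂ (all₃ b c a)) (q∤x ∘ _))
      ... | no a  | no b  | yes c | yes d = merged a b c d
      ... | no a  | yes b | no c  | yes d = zeroSum-permute (transpose 1F 2F) (merged a c b d)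
      ... | no a  | yes b | yes c | no d  = zeroSum-permute (transpose 1F 3F) (merged a d c b)
      ... | yes a | no b  | no c  | yes d = zeroSum-permute (transpose 0F 2F) (merged c b a d)
      ... | yes a | no b  | yes c | no d  = zeroSum-permute (transpose 0F 3F) (merged d b c a)
      ... | yes a | yes b | no c  | no d  = zeroSum-permute (transpose 0F 2F ∘ₚ transpose 1F 3F) (merged c d a b)

    -- A term divisible by q is moved to the front; otherwise either three terms share their
    -- divisibility by p and are moved to the back, or two units mod p are moved to the front.
    L-davenport : AllHaveWZS L n 4
    L-davenport x with any? (λ i → q ∣? x i)
    ... | yes (i , q∣xᵢ) = zeroSum⇒hasWZS (zeroSum-permute (transpose 0F i) (with-q-multiple _ q∣xᵢ))
    ... | no ¬q∣x        = zeroSum⇒hasWZS (q-units x λ i q∣xᵢ → ¬q∣x (i , q∣xᵢ))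

  no-zeroSum-i : ∀ {l} {y : Seq (suc l)} → q ∣ y zero → ¬ n ∣ y zero →
    ¬ HasWZS (InQ q) q (tail y) → ¬ ZeroSum InUQ n y
  no-zeroSum-i {y = y} q∣y₀ n∤y₀ ¬zs Z@(zeroSum b (i , bᵢ) w w∈UQ n∣Σ)
    with any? (λ i → b (suc i) Bool.≟ true)
  ... | yes tail-selected =
    ¬zs (zeroSum⇒hasWZS (zeroSum-tail (zeroSum-map proj₂ (n∣m*n p) Z) (q∣head (b zero)) tail-selected))
    where
    q∣head : ∀ s → q ∣ (if s then w zero * y zero else 0)
    q∣head true  = ∣n⇒∣m*n (w zero) q∣y₀
    q∣head false = q ∣0
  ... | no tail-unselected = n∤y₀ (p∣∧q∣⇒n∣ p∣y₀ q∣y₀)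
    where
    head-selected : ∀ j → b j ≡ true → b zero ≡ true
    head-selected zero    bⱼ = bⱼ
    head-selected (suc j) bⱼ = ⊥-elim (tail-unselected (j , bⱼ))
    b₀ = head-selected i bᵢ
    p∣w₀y₀ : p ∣ w zero * y zero
    p∣w₀y₀ = subst (p ∣_) (trans (cong₂ _+_ (cong (λ s → if s then w zero * y zero else 0) b₀)
                                              (selectedSum-none _ (λ j bⱼ → tail-unselected (j , bⱼ))))
                                 (+-identityʳ _))
                   (∣-trans (m∣m*n q) n∣Σ)
    p∣y₀ : p ∣ y zero
    p∣y₀ = [ (λ p∣w₀ → ⊥-elim (proj₁ (w∈UQ zero b₀) p∣w₀)) , (λ p∣y₀ → p∣y₀) ]
             (euclidsLemma (w zero) (y zero) p-prime p∣w₀y₀)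

  no-zeroSum-ii : ∀ {l} {y : Seq (suc l)} → ¬ p ∣ y zero → (∀ i → p ∣ y (suc i)) →
    ¬ HasWZS (InQ q) q (tail y) → ¬ ZeroSum InUQ n y
  no-zeroSum-ii {y = y} p∤y₀ p∣ys ¬zs (zeroSum b (i , bᵢ) w w∈UQ n∣Σ) with b zero in b₀
  ... | true = prime-∤-* p-prime (proj₁ (w∈UQ zero b₀)) p∤y₀
                 (∣m+n∣m⇒∣n (subst (p ∣_) (+-comm (w zero * y zero) rest) (∣-trans (m∣m*n q) n∣Σ))
                            (∣-selectedSum {b = tail b} {λ j → w (suc j) * y (suc j)}
                                           λ j _ → ∣n⇒∣m*n (w (suc j)) (p∣ys j)))
    where
    rest = selectedSum (tail b) (λ j → w (suc j) * y (suc j))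
  ... | false with i
  ...   | zero  = ⊥-elim (subst T (trans (sym bᵢ) b₀) _)
  ...   | suc j = ¬zs (zeroSum⇒hasWZS {InQ q} {q}
                    (zeroSum (tail b) (j , bᵢ) (tail w) (λ j bⱼ → proj₂ (w∈UQ (suc j) bⱼ))
                             (∣-trans (n∣m*n p {q}) n∣Σ)))

  transport : ∀ {l} {x y : Seq l} → Equivalent L n x y → HasWZS L n x → ZeroSum InUQ n y
  transport x∼y zs = zeroSum-transport L⇒InUQ InUQ-1 InUQ-* x∼y (hasWZS⇒zeroSum zs)

theorem5p6 : (p′ q : ℕ) → Prime p′ → Prime q → p′ ≢ q → 7 ≤ p′ → 7 ≤ q →
    (x y : Seq 3) →
    Equivalent (InL ((p′ , 1) ∷ (q , 1) ∷ []) (p′ * q) p′) (p′ * q) x y →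
    ((q ∣ y zero × ¬ (q ∣ y (suc zero)) × ¬ (q ∣ y (suc (suc zero)))
        × ¬ (y zero ≡ 0 [mod p′ * q ])
        × Extremal (InQ q) q (λ i → y (suc i)))
     ⊎ (Coprime (y zero) p′ × ¬ Coprime (y (suc zero)) p′ × ¬ Coprime (y (suc (suc zero))) p′
        × Extremal (InQ q) q (λ i → y (suc i)))) →
    Extremal (InL ((p′ , 1) ∷ (q , 1) ∷ []) (p′ * q) p′) (p′ * q) x
theorem5p6 p′ q p′-prime q-prime p′≢q (s≤s (s≤s 5≤k)) _ x y x∼y
           (inj₁ (q∣y₀ , _ , _ , y₀≢0 , (Q-davenport , _) , ¬Q-zs)) =
  extremal {L} {n} (L-davenport Q-davenport)
    (no-zeroSum-i {y = y} q∣y₀ (λ n∣y₀ → y₀≢0 (∣⇒≡0-mod n∣y₀)) ¬Q-zs ∘ transport x∼y)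
  where open TwoPrimes _ q (≤-trans (s≤s z≤n) 5≤k) p′-prime q-prime p′≢q
theorem5p6 p′ q p′-prime q-prime p′≢q (s≤s (s≤s 5≤k)) _ x y x∼y
           (inj₂ (y₀⊥p′ , ¬y₁⊥p′ , ¬y₂⊥p′ , (Q-davenport , _) , ¬Q-zs)) =
  extremal {L} {n} (L-davenport Q-davenport)
    (no-zeroSum-ii {y = y} (coprime⇒prime-∤ p′-prime y₀⊥p′ ∣-refl) p′∣ys ¬Q-zs ∘ transport x∼y)
  where
  open TwoPrimes _ q (≤-trans (s≤s z≤n) 5≤k) p′-prime q-prime p′≢q
  p′∣ys : ∀ i → p′ ∣ y (suc i)
  p′∣ys 0F = ¬coprime⇒prime-∣ p′-prime ¬y₁⊥p′
  p′∣ys 1F = ¬coprime⇒prime-∣ p′-prime ¬y₂⊥p′
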